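{- Let $p$ be a Sophie Germain prime with $p\equiv 1, 3$ or $5 \pmod 8$, and let $k\geq 1$ be an integer. Then the only non-negative integer solutions of the equation $-p^x+(2^{k}(2p+1))^y=z^2$ are $(x,y,z)=(0,0,0)$ (for any $p,k$) and $(p,k,x,y,z)=(3,1,3,2,13)$, $(3,2,3,1,1)$, $(3,2,1,1,5)$, $(11,2,1,1,9)$.
   Context: A prime $p$ is called a Sophie Germain prime if $2p+1$ is also prime. -}

module Defs where

open import Data.Nat using (ℕ; _+_; _*_; _%_)
open import Data.Nat.Primality using (Prime)
open import Data.Product using (_×_)
open import Data.Sum using (_⊎_)
open import Relation.Binary.PropositionalEquality using (_≡_)
open import Data.Integer as ℤ using (ℤ; +_)

SophieGermain : ℕ → Set
SophieGermain p = Prime p × Prime (2 * p + 1)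

Mod8Cond : ℕ → Set
Mod8Cond p = (p % 8 ≡ 1) ⊎ (p % 8 ≡ 3) ⊎ (p % 8 ≡ 5)

IsSolution : (p k x y z : ℕ) → Set
IsSolution p k x y z =
  (ℤ.- ((+ p) ℤ.^ x)) ℤ.+ ((+ (2 Data.Nat.^ k * (2 * p + 1))) ℤ.^ y) ≡ (+ z) ℤ.^ 2
  where import Data.Nat

Listed : (p k x y z : ℕ) → Set
Listed p k x y z =
  (x ≡ 0 × y ≡ 0 × z ≡ 0)
  ⊎ (p ≡ 3 × k ≡ 1 × x ≡ 3 × y ≡ 2 × z ≡ 13)
  ⊎ (p ≡ 3 × k ≡ 2 × x ≡ 3 × y ≡ 1 × z ≡ 1)
  ⊎ (p ≡ 3 × k ≡ 2 × x ≡ 1 × y ≡ 1 × z ≡ 5)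
  ⊎ (p ≡ 11 × k ≡ 2 × x ≡ 1 × y ≡ 1 × z ≡ 9)

{-# OPTIONS --safe #-}
module Submission where

-- Write Q = 2^k (2p+1), so that the equation reads p^x + z² = Q^y.  As p ≡ 1, 3 or 5
-- (mod 8), so is every power of p, while squares are ≡ 0, 1 or 4; hence 8 ∤ p^x + z²,
-- which forces k y ≤ 2.  The three remaining cases are settled separately:
-- (k, y) = (1, 1) by residues mod 8 and mod 3 and by size; (1, 2) by factoring
-- Q² − z² = (Q − z)(Q + z) into two powers of p, one of which must be 1; and (2, 1) by
-- residues and size, except for x = 1, where (z − 2)(z + 2) = 7p is solved by Euclid's lemma.

open import Defs
open import Data.Nat using (ℕ; _≥_)
open import Function.Bundles using (_⇔_; mk⇔)
open import Function.Base using (_∘_)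

open import Data.Nat.Base
open import Data.Nat.Properties
open import Data.Nat.DivMod
open import Data.Nat.Divisibility
open import Data.Nat.Primality
open import Data.Nat.Coprimality using (Coprime; coprime-divisor)
open import Data.Nat.Tactic.RingSolver using (solve)
open import Data.List.Base using (_∷_; [])
open import Data.Product using (_×_; _,_)
open import Data.Sum using (_⊎_; inj₁; inj₂; reduce)
open import Data.Empty using (⊥-elim)
open import Relation.Nullary using (¬_; contradiction)
open import Relation.Nullary.Decidable using (Dec; yes; no; from-yes; from-no; ¬?; _⊎-dec_; _→-dec_)
open import Relation.Binary.Definitions using (tri<; tri≈; tri>)
open import Relation.Binary.PropositionalEquality
import Data.Integer as ℤ
import Data.Integer.Properties as ℤ

private variable a c d i j m n p q w x z : ℕ

^-monoˡ-∣ : ∀ n → d ∣ m → d ^ n ∣ m ^ n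
^-monoˡ-∣ zero    d∣m = ∣-refl
^-monoˡ-∣ (suc n) d∣m = *-pres-∣ d∣m (^-monoˡ-∣ n d∣m)

^-monoʳ-∣ : ∀ m → i ≤ j → m ^ i ∣ m ^ j
^-monoʳ-∣ {i = i} m i≤j with m≤n⇒∃[o]m+o≡n i≤j
... | o , refl = subst (m ^ i ∣_) (sym (^-distribˡ-+-* m i o)) (m∣m*n (m ^ o))

^-injectiveʳ : 1 < m → m ^ i ≡ m ^ j → i ≡ j
^-injectiveʳ {m = m} {i = i} {j = j} 1<m eq with <-cmp i j
... | tri< i<j _ _ = contradiction eq (<⇒≢ (^-monoʳ-< m 1<m i<j))
... | tri≈ _ i≡j _ = i≡j
... | tri> _ _ j<i = contradiction (sym eq) (<⇒≢ (^-monoʳ-< m 1<m j<i))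

8∣[2^k*m]^y : ∀ k m y → 3 ≤ k * y → 8 ∣ (2 ^ k * m) ^ y
8∣[2^k*m]^y k m y 3≤ky = ∣-trans (^-monoʳ-∣ 2 3≤ky)
  (subst (_∣ (2 ^ k * m) ^ y) (^-*-assoc 2 k y) (^-monoˡ-∣ y (m∣m*n m)))

m*m*p≤p^[3+x] : .{{_ : NonZero p}} → m ≤ p → ∀ x → m * m * p ≤ p ^ (3 + x)
m*m*p≤p^[3+x] {p} {m} m≤p x = begin
  m * m * p           ≤⟨ *-monoˡ-≤ p (*-mono-≤ m≤p m≤p) ⟩
  p * p * p           ≡⟨ solve (p ∷ []) ⟩
  p * (p * (p * 1))   ≤⟨ ^-monoʳ-≤ p (m≤m+n 3 x) ⟩
  p ^ (3 + x)         ∎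
  where open ≤-Reasoning

∣p^x∧p∤d⇒d≡1 : Prime p → ∀ x → d ∣ p ^ x → ¬ p ∣ d → d ≡ 1
∣p^x∧p∤d⇒d≡1         pr zero    d∣1   _   = ∣1⇒≡1 d∣1
∣p^x∧p∤d⇒d≡1 {p = p} {d = d} pr (suc x) d∣p^x p∤d =
  ∣p^x∧p∤d⇒d≡1 pr x (coprime-divisor d⊥p d∣p^x) p∤d
  where
  d⊥p : Coprime d p
  d⊥p (i∣d , i∣p) with prime⇒irreducible pr i∣p
  ... | inj₁ i≡1 = i≡1
  ... | inj₂ refl = contradiction i∣d p∤d

m*n≡c*p⇒m∣c⊎n∣c : Prime p → m * n ≡ c * p → m ∣ c ⊎ n ∣ c
m*n≡c*p⇒m∣c⊎n∣c {p = p} {m = m} {n = n} {c = c} pr eq with euclidsLemma m n pr (divides c eq)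
... | inj₁ (divides a refl) = inj₂ (divides a (*-cancelʳ-≡ c (a * n) p (begin
  c * p           ≡⟨ eq ⟨
  a * p * n       ≡⟨ solve (a ∷ p ∷ n ∷ []) ⟩
  a * n * p       ∎)))
  where instance _ = prime⇒nonZero pr
        open ≡-Reasoning
... | inj₂ (divides b refl) = inj₁ (divides b (*-cancelʳ-≡ c (b * m) p (begin
  c * p           ≡⟨ eq ⟨
  m * (b * p)     ≡⟨ solve (m ∷ b ∷ p ∷ []) ⟩
  b * m * p       ∎)))
  where instance _ = prime⇒nonZero pr
        open ≡-Reasoning

a+z*z≡q*q⇒z<q : 0 < a → a + z * z ≡ q * q → z < q
a+z*z≡q*q⇒z<q {a} {z} {q} 0<a eq with <-cmp z q
... | tri< z<q _ _ = z<q
... | tri≈ _ refl _ = contradiction (+-cancelʳ-≡ (z * z) a 0 eq) (>⇒≢ 0<a)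
... | tri> _ _ q<z = contradiction eq (>⇒≢ (begin-strict
  q * q       ≤⟨ *-mono-≤ (<⇒≤ q<z) (<⇒≤ q<z) ⟩
  z * z       <⟨ +-monoˡ-< (z * z) 0<a ⟩
  a + z * z   ∎))
  where open ≤-Reasoning

p^x+z*z≡q*q⇒q≡1+z : Prime p → ¬ p ∣ 2 * q → p ^ x + z * z ≡ q * q → q ≡ 1 + z
p^x+z*z≡q*q⇒q≡1+z {p} {q} {x} {z} pr p∤2q eq
  with m≤n⇒∃[o]m+o≡n (a+z*z≡q*q⇒z<q {a = p ^ x} {z = z} {q = q} (m^n>0 p {{prime⇒nonZero pr}} x) eq)
... | d , refl = trans (cong (λ t → 1 + z + t) d≡0) (+-identityʳ (1 + z))
  where
  open ≡-Reasoning
  e : ℕ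
  e = 1 + d + 2 * z
  p^x≡[1+d]*e : p ^ x ≡ (1 + d) * e
  p^x≡[1+d]*e = +-cancelʳ-≡ (z * z) _ _ (begin
    p ^ x + z * z                       ≡⟨ eq ⟩
    (1 + z + d) * (1 + z + d)           ≡⟨ solve (z ∷ d ∷ []) ⟩
    (1 + d) * (1 + d + 2 * z) + z * z   ∎)
  1+d+e≡2q : (1 + d) + (1 + d + 2 * z) ≡ 2 * (1 + z + d)
  1+d+e≡2q = solve (z ∷ d ∷ [])
  d≡0 : d ≡ 0
  d≡0 with p ∣? 1 + d | p ∣? e
  ... | no p∤1+d   | _      =
    suc-injective (∣p^x∧p∤d⇒d≡1 pr x (divides e (trans p^x≡[1+d]*e (*-comm (1 + d) e))) p∤1+d)
  ... | yes _      | no p∤e =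
    m+n≡0⇒m≡0 d (suc-injective (∣p^x∧p∤d⇒d≡1 pr x (divides (1 + d) p^x≡[1+d]*e) p∤e))
  ... | yes p∣1+d | yes p∣e =
    contradiction (subst (p ∣_) 1+d+e≡2q (∣m∣n⇒∣m+n p∣1+d p∣e)) p∤2q

p^x+z*z≡1⇒x≡0∧z≡0 : Prime p → p ^ x + z * z ≡ 1 → x ≡ 0 × z ≡ 0
p^x+z*z≡1⇒x≡0∧z≡0 {x = zero}  {z = zero}  _ _  = refl , refl
p^x+z*z≡1⇒x≡0∧z≡0 {x = zero}  {z = suc z} _ ()
p^x+z*z≡1⇒x≡0∧z≡0 {p} {suc x} {z}         pr eq = contradiction (begin-strict
  1                   <⟨ nonTrivial⇒n>1 p ⟩
  p                   ≤⟨ m≤m*n p (p ^ x) ⟩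
  p ^ suc x           ≤⟨ m≤m+n _ (z * z) ⟩
  p ^ suc x + z * z   ≡⟨ eq ⟩
  1                   ∎) (<-irrefl refl)
  where
  instance _ = prime⇒nonTrivial pr
           _ = prime⇒nonZero pr
           _ = m^n≢0 p x
  open ≤-Reasoning

%-*-unitˡ : ∀ a b {n} .{{_ : NonZero n}} → a % n ≡ 1 → (a * b) % n ≡ b % n
%-*-unitˡ a b {n} a%n≡1 = begin
  (a * b) % n             ≡⟨ %-distribˡ-* a b n ⟩
  (a % n * (b % n)) % n   ≡⟨ cong (λ r → (r * (b % n)) % n) a%n≡1 ⟩
  (1 * (b % n)) % n       ≡⟨ cong (_% n) (*-identityˡ (b % n)) ⟩
  b % n % n               ≡⟨ m%n%n≡m%n b n ⟩
  b % n                   ∎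
  where open ≡-Reasoning

SquaresAvoid : ∀ n .{{_ : NonZero n}} → ℕ → ℕ → Set
SquaresAvoid n b d = ∀ {r} → r < n → (b + r * r) % n ≢ d

squaresAvoid? : ∀ n .{{_ : NonZero n}} b d → Dec (SquaresAvoid n b d)
squaresAvoid? n b d = allUpTo? (λ r → ¬? ((b + r * r) % n ≟ d)) n

[a+z*z]%n≢d : ∀ n .{{_ : NonZero n}} {a b d} z →
              a % n ≡ b → SquaresAvoid n b d → (a + z * z) % n ≢ d
[a+z*z]%n≢d n {a} {b} z refl avoid = λ eq → avoid (m%n<n z n) (trans residue eq)
  where
  open ≡-Reasoning
  residue : (a % n + z % n * (z % n)) % n ≡ (a + z * z) % n
  residue = begin
    (a % n + z % n * (z % n)) % n           ≡⟨ %-distribˡ-+ (a % n) _ n ⟩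
    (a % n % n + (z % n * (z % n)) % n) % n
      ≡⟨ cong₂ (λ u v → (u + v) % n) (m%n%n≡m%n a n) (sym (%-distribˡ-* z z n)) ⟩
    (a % n + (z * z) % n) % n               ≡⟨ %-distribˡ-+ a (z * z) n ⟨
    (a + z * z) % n                         ∎

mod8-elim : (P : ℕ → Set) → P 1 → P 3 → P 5 → Mod8Cond p → P (p % 8)
mod8-elim P P1 P3 P5 (inj₁ p≡1)         rewrite p≡1 = P1
mod8-elim P P1 P3 P5 (inj₂ (inj₁ p≡3)) rewrite p≡3 = P3
mod8-elim P P1 P3 P5 (inj₂ (inj₂ p≡5)) rewrite p≡5 = P5

mod8-prime⇒3≤p : Prime p → Mod8Cond p → 3 ≤ p
mod8-prime⇒3≤p {0} pr _                 = contradiction pr ¬prime[0]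
mod8-prime⇒3≤p {1} pr _                 = contradiction pr ¬prime[1]
mod8-prime⇒3≤p {2} _  (inj₁ ())
mod8-prime⇒3≤p {2} _  (inj₂ (inj₁ ()))
mod8-prime⇒3≤p {2} _  (inj₂ (inj₂ ()))
mod8-prime⇒3≤p {suc (suc (suc _))} _ _ = s≤s (s≤s (s≤s z≤n))

mod8-prime≤3⇒≡3 : Prime p → Mod8Cond p → p ≤ 3 → p ≡ 3
mod8-prime≤3⇒≡3 pr md p≤3 = ≤-antisym p≤3 (mod8-prime⇒3≤p pr md)

mod8-prime∤4 : Prime p → Mod8Cond p → ¬ p ∣ 4
mod8-prime∤4 pr md p∣4 = <⇒≱ (mod8-prime⇒3≤p pr md) (∣⇒≤ (reduce (euclidsLemma 2 2 pr p∣4)))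

mod8⇒p*p%8≡1 : Mod8Cond p → (p * p) % 8 ≡ 1
mod8⇒p*p%8≡1 {p} md =
  trans (%-distribˡ-* p p 8) (mod8-elim {p = p} (λ r → (r * r) % 8 ≡ 1) refl refl refl md)

mod8⇒[2+4p]%8≡6 : Mod8Cond p → (2 + 4 * p) % 8 ≡ 6
mod8⇒[2+4p]%8≡6 {p} md = begin
  (2 + 4 * p) % 8               ≡⟨ %-distribˡ-+ 2 (4 * p) 8 ⟩
  (2 + (4 * p) % 8) % 8         ≡⟨ cong (λ r → (2 + r) % 8) (%-distribˡ-* 4 p 8) ⟩
  (2 + (4 * (p % 8)) % 8) % 8
    ≡⟨ mod8-elim {p = p} (λ r → (2 + (4 * r) % 8) % 8 ≡ 6) refl refl refl md ⟩
  6                             ∎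
  where open ≡-Reasoning

mod8⇒p^[2+x]%8≡p^x%8 : Mod8Cond p → ∀ x → p ^ (2 + x) % 8 ≡ p ^ x % 8
mod8⇒p^[2+x]%8≡p^x%8 {p} md x = begin
  p * (p * p ^ x) % 8   ≡⟨ cong (_% 8) (*-assoc p p (p ^ x)) ⟨
  p * p * p ^ x % 8     ≡⟨ %-*-unitˡ (p * p) (p ^ x) (mod8⇒p*p%8≡1 {p = p} md) ⟩
  p ^ x % 8             ∎
  where open ≡-Reasoning

mod8-^ : Mod8Cond p → ∀ x → Mod8Cond (p ^ x)
mod8-^     md zero          = inj₁ refl
mod8-^ {p} md (suc zero)    = subst Mod8Cond (sym (*-identityʳ p)) md
mod8-^ {p} md (suc (suc x)) = subst (λ r → (r ≡ 1) ⊎ (r ≡ 3) ⊎ (r ≡ 5))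
  (sym (mod8⇒p^[2+x]%8≡p^x%8 {p} md x)) (mod8-^ md x)

mod8⇒8∤a+z*z : Mod8Cond a → ∀ z → ¬ 8 ∣ a + z * z
mod8⇒8∤a+z*z {a} md z 8∣ = avoids md (n∣m⇒m%n≡0 (a + z * z) 8 8∣)
  where
  avoids : Mod8Cond a → (a + z * z) % 8 ≢ 0
  avoids (inj₁ a≡1)        = [a+z*z]%n≢d 8 {a = a} z a≡1 (from-yes (squaresAvoid? 8 1 0))
  avoids (inj₂ (inj₁ a≡3)) = [a+z*z]%n≢d 8 {a = a} z a≡3 (from-yes (squaresAvoid? 8 3 0))
  avoids (inj₂ (inj₂ a≡5)) = [a+z*z]%n≢d 8 {a = a} z a≡5 (from-yes (squaresAvoid? 8 5 0))

3≤k*y⇒p^x+z*z≢[2^k*m]^y : ∀ p x z k m y → Mod8Cond p → 3 ≤ k * y →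
                          p ^ x + z * z ≢ (2 ^ k * m) ^ y
3≤k*y⇒p^x+z*z≢[2^k*m]^y p x z k m y md 3≤ky eq =
  mod8⇒8∤a+z*z (mod8-^ {p} md x) z (subst (8 ∣_) (sym eq) (8∣[2^k*m]^y k m y 3≤ky))

p^x+z*z≢2+4p : Prime p → Mod8Cond p → ∀ x z → p ^ x + z * z ≢ 2 + 4 * p
p^x+z*z≢2+4p {p} _ md 0 z eq =
  [a+z*z]%n≢d 8 {a = 1} z refl
    (from-yes (squaresAvoid? 8 1 6)) (trans (cong (_% 8) eq) (mod8⇒[2+4p]%8≡6 {p} md))
p^x+z*z≢2+4p {p} _ md 1 z eq =
  [a+z*z]%n≢d 3 {a = 0} z refl
    (from-yes (squaresAvoid? 3 0 2))
    (trans (cong (_% 3) z*z≡2+3p) (%-remove-+ʳ 2 {d = 3} (n∣m*n p)))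
  where
  open ≡-Reasoning
  z*z≡2+3p : z * z ≡ 2 + p * 3
  z*z≡2+3p = +-cancelˡ-≡ (p * 1) _ _ (begin
    p * 1 + z * z         ≡⟨ eq ⟩
    2 + 4 * p             ≡⟨ solve (p ∷ []) ⟩
    p * 1 + (2 + p * 3)   ∎)
p^x+z*z≢2+4p {p} _ md 2 z eq =
  [a+z*z]%n≢d 8 {a = p ^ 2} z (mod8⇒p^[2+x]%8≡p^x%8 {p} md 0)
    (from-yes (squaresAvoid? 8 1 6)) (trans (cong (_% 8) eq) (mod8⇒[2+4p]%8≡6 {p} md))
p^x+z*z≢2+4p {p} pr md (suc (suc (suc x))) z eq = <⇒≱ 2+4p<9p (begin
  3 * 3 * p             ≤⟨ m*m*p≤p^[3+x] 3≤p x ⟩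
  p ^ (3 + x)           ≤⟨ m≤m+n _ (z * z) ⟩
  p ^ (3 + x) + z * z   ≡⟨ eq ⟩
  2 + 4 * p             ∎)
  where
  instance _ = prime⇒nonZero pr
  open ≤-Reasoning
  3≤p : 3 ≤ p
  3≤p = mod8-prime⇒3≤p pr md
  2+4p<9p : 2 + 4 * p < 3 * 3 * p
  2+4p<9p = begin-strict
    2 + 4 * p       <⟨ +-monoˡ-< (4 * p) {2} {5} (s≤s (s≤s (s≤s z≤n))) ⟩
    5 + 4 * p       ≤⟨ +-monoˡ-≤ (4 * p) (*-monoʳ-≤ 5 (≤-trans (s≤s z≤n) 3≤p)) ⟩
    5 * p + 4 * p   ≡⟨ solve (p ∷ []) ⟩
    3 * 3 * p       ∎

p^x+z*z≡[2+4p]²⇒listed : Prime p → Mod8Cond p →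
  ∀ x z → p ^ x + z * z ≡ (2 + 4 * p) * (2 + 4 * p) → Listed p 1 x 2 z
p^x+z*z≡[2+4p]²⇒listed {p} pr md x z eq = inj₂ (inj₁ (p≡3 , refl , x≡3 , refl , z≡13))
  where
  open ≡-Reasoning
  p∤2q : ¬ p ∣ 2 * (2 + 4 * p)
  p∤2q p∣2q = mod8-prime∤4 pr md (∣m+n∣m⇒∣n (subst (p ∣_) 2q≡8p+4 p∣2q) (m∣m*n 8))
    where
    2q≡8p+4 : 2 * (2 + 4 * p) ≡ p * 8 + 4
    2q≡8p+4 = solve (p ∷ [])
  z≡1+4p : z ≡ 1 + 4 * p
  z≡1+4p = suc-injective (sym (p^x+z*z≡q*q⇒q≡1+z {x = x} pr p∤2q eq))
  p^x≡8p+3 : p ^ x ≡ p * 8 + 3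
  p^x≡8p+3 = +-cancelʳ-≡ (z * z) _ _ (begin
    p ^ x + z * z                           ≡⟨ eq ⟩
    (2 + 4 * p) * (2 + 4 * p)               ≡⟨ solve (p ∷ []) ⟩
    p * 8 + 3 + (1 + 4 * p) * (1 + 4 * p)   ≡⟨ cong (λ t → p * 8 + 3 + t * t) z≡1+4p ⟨
    p * 8 + 3 + z * z                       ∎)
  p∣3 : ∀ n → p ^ n ≡ p * 8 + 3 → p ∣ 3
  p∣3 zero    1≡8p+3   = contradiction 1≡8p+3 (<⇒≢ (≤-trans (s≤s (s≤s z≤n)) (m≤n+m 3 (p * 8))))
  p∣3 (suc n) p^n≡8p+3 = ∣m+n∣m⇒∣n (subst (p ∣_) p^n≡8p+3 (m∣m*n (p ^ n))) (m∣m*n 8)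
  p≡3 : p ≡ 3
  p≡3 = mod8-prime≤3⇒≡3 pr md (∣⇒≤ (p∣3 x p^x≡8p+3))
  x≡3 : x ≡ 3
  x≡3 = ^-injectiveʳ (s≤s (s≤s z≤n)) (subst (λ r → r ^ x ≡ r * 8 + 3) p≡3 p^x≡8p+3)
  z≡13 : z ≡ 13
  z≡13 = trans z≡1+4p (cong (λ r → 1 + 4 * r) p≡3)

w*[4+w]≡7p⇒w<8 : Prime p → w * (4 + w) ≡ 7 * p → w < 8
w*[4+w]≡7p⇒w<8 {p = p} {w = w} pr eq with m*n≡c*p⇒m∣c⊎n∣c pr eq
... | inj₁ w∣7   = s≤s (∣⇒≤ w∣7)
... | inj₂ 4+w∣7 = s≤s (≤-trans (m≤n+m w 4) (∣⇒≤ 4+w∣7))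

w<8∧7∣w*[4+w]⇒w∈[0,3,7] : w < 8 → 7 ∣ w * (4 + w) → w ≡ 0 ⊎ w ≡ 3 ⊎ w ≡ 7
w<8∧7∣w*[4+w]⇒w∈[0,3,7] =
  from-yes (allUpTo? (λ w → 7 ∣? w * (4 + w) →-dec (w ≟ 0 ⊎-dec w ≟ 3 ⊎-dec w ≟ 7)) 8)

w*[4+w]≡7p-solutions : Prime p → w * (4 + w) ≡ 7 * p → (w ≡ 3 × p ≡ 3) ⊎ (w ≡ 7 × p ≡ 11)
w*[4+w]≡7p-solutions {p = p} {w = w} pr eq
  with w<8∧7∣w*[4+w]⇒w∈[0,3,7] {w} (w*[4+w]≡7p⇒w<8 pr eq) (divides p (trans eq (*-comm 7 p)))
... | inj₁ refl        = contradiction (subst Prime (*-cancelˡ-≡ p 0 7 (sym eq)) pr) ¬prime[0]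
... | inj₂ (inj₁ refl) = inj₁ (refl , *-cancelˡ-≡ p 3 7 (sym eq))
... | inj₂ (inj₂ refl) = inj₂ (refl , *-cancelˡ-≡ p 11 7 (sym eq))

z*z≡4+7p-solutions : Prime p → z * z ≡ 4 + 7 * p → (p ≡ 3 × z ≡ 5) ⊎ (p ≡ 11 × z ≡ 9)
z*z≡4+7p-solutions {z = 0} _ ()
z*z≡4+7p-solutions {z = 1} _ ()
z*z≡4+7p-solutions {p = p} {z = suc (suc w)} pr eq
  with w*[4+w]≡7p-solutions {w = w} pr (+-cancelˡ-≡ 4 _ _ (begin
  4 + w * (4 + w)       ≡⟨ solve (w ∷ []) ⟩
  (2 + w) * (2 + w)     ≡⟨ eq ⟩
  4 + 7 * p             ∎))
  where open ≡-Reasoning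
... | inj₁ (refl , p≡3)  = inj₁ (p≡3 , refl)
... | inj₂ (refl , p≡11) = inj₂ (p≡11 , refl)

3^[3+x]+z*z≡28⇒x≡0∧z≡1 : ∀ x z → 3 ^ (3 + x) + z * z ≡ 28 → x ≡ 0 × z ≡ 1
3^[3+x]+z*z≡28⇒x≡0∧z≡1 zero    z eq = refl , m*n≡1⇒m≡1 z z (+-cancelˡ-≡ 27 _ _ eq)
3^[3+x]+z*z≡28⇒x≡0∧z≡1 (suc x) z eq = contradiction (begin
  3 ^ 4                 ≤⟨ ^-monoʳ-≤ 3 (m≤m+n 4 x) ⟩
  3 ^ (4 + x)           ≤⟨ m≤m+n _ (z * z) ⟩
  3 ^ (4 + x) + z * z   ≡⟨ eq ⟩
  28                    ∎) (from-no (81 ≤? 28))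
  where open ≤-Reasoning

p^x+z*z≡4+8p⇒listed : Prime p → Mod8Cond p →
  ∀ x z → p ^ x + z * z ≡ 4 + 8 * p → Listed p 2 x 1 z
p^x+z*z≡4+8p⇒listed {p} _ md 0 z eq = ⊥-elim
  ([a+z*z]%n≢d 8 {a = 1} z refl
    (from-yes (squaresAvoid? 8 1 4)) (trans (cong (_% 8) eq) (%-remove-+ʳ 4 {d = 8} (m∣m*n p))))
p^x+z*z≡4+8p⇒listed {p} pr md 1 z eq
  with z*z≡4+7p-solutions pr (+-cancelˡ-≡ (p * 1) _ _ (begin
  p * 1 + z * z         ≡⟨ eq ⟩
  4 + 8 * p             ≡⟨ solve (p ∷ []) ⟩
  p * 1 + (4 + 7 * p)   ∎))
  where open ≡-Reasoning
... | inj₁ (p≡3 , z≡5)  = inj₂ (inj₂ (inj₂ (inj₁ (p≡3 , refl , refl , refl , z≡5))))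
... | inj₂ (p≡11 , z≡9) = inj₂ (inj₂ (inj₂ (inj₂ (p≡11 , refl , refl , refl , z≡9))))
p^x+z*z≡4+8p⇒listed {p} _ md 2 z eq = ⊥-elim
  ([a+z*z]%n≢d 8 {a = p ^ 2} z (mod8⇒p^[2+x]%8≡p^x%8 {p} md 0)
    (from-yes (squaresAvoid? 8 1 4)) (trans (cong (_% 8) eq) (%-remove-+ʳ 4 {d = 8} (m∣m*n p))))
p^x+z*z≡4+8p⇒listed {p} pr md (suc (suc (suc x))) z eq with 4 ≤? p
... | yes 4≤p = ⊥-elim (<⇒≱ 4+8p<16p (begin
  4 * 4 * p             ≤⟨ m*m*p≤p^[3+x] 4≤p x ⟩
  p ^ (3 + x)           ≤⟨ m≤m+n _ (z * z) ⟩
  p ^ (3 + x) + z * z   ≡⟨ eq ⟩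
  4 + 8 * p             ∎))
  where
  instance _ = prime⇒nonZero pr
  open ≤-Reasoning
  4+8p<16p : 4 + 8 * p < 4 * 4 * p
  4+8p<16p = begin-strict
    4 + 8 * p       <⟨ +-monoˡ-< (8 * p) {4} {8} (s≤s (s≤s (s≤s (s≤s (s≤s z≤n))))) ⟩
    8 + 8 * p       ≤⟨ +-monoˡ-≤ (8 * p) (*-monoʳ-≤ 8 (≤-trans (s≤s z≤n) 4≤p)) ⟩
    8 * p + 8 * p   ≡⟨ solve (p ∷ []) ⟩
    4 * 4 * p       ∎
... | no 4≰p with mod8-prime≤3⇒≡3 pr md (m<1+n⇒m≤n (≰⇒> 4≰p))
...   | refl with 3^[3+x]+z*z≡28⇒x≡0∧z≡1 x z eq
...     | refl , z≡1 = inj₂ (inj₂ (inj₁ (refl , refl , refl , refl , z≡1)))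

pos-^ : ∀ m n → (ℤ.+ m) ℤ.^ n ≡ ℤ.+ (m ^ n)
pos-^ m zero    = refl
pos-^ m (suc n) = trans (cong ((ℤ.+ m) ℤ.*_) (pos-^ m n)) (sym (ℤ.pos-* m (m ^ n)))

-i+j≡k⇒j≡i+k : ∀ i j k → ℤ.- i ℤ.+ j ≡ k → j ≡ i ℤ.+ k
-i+j≡k⇒j≡i+k i j k eq = begin
  j                      ≡⟨ ℤ.+-identityˡ j ⟨
  ℤ.0ℤ ℤ.+ j             ≡⟨ cong (ℤ._+ j) (ℤ.+-inverseʳ i) ⟨
  i ℤ.+ ℤ.- i ℤ.+ j      ≡⟨ ℤ.+-assoc i (ℤ.- i) j ⟩
  i ℤ.+ (ℤ.- i ℤ.+ j)    ≡⟨ cong (λ t → i ℤ.+ t) eq ⟩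
  i ℤ.+ k                ∎
  where open ≡-Reasoning

solution⇒equation : ∀ {p k x y z} → IsSolution p k x y z →
                    p ^ x + z * z ≡ (2 ^ k * (2 * p + 1)) ^ y
solution⇒equation {p} {k} {x} {y} {z} sol = ℤ.+-injective (begin
  ℤ.+ (p ^ x + z * z)               ≡⟨ cong (λ t → ℤ.+ (p ^ x + z * t)) (*-identityʳ z) ⟨
  ℤ.+ (p ^ x + z ^ 2)               ≡⟨ ℤ.pos-+ (p ^ x) (z ^ 2) ⟩
  ℤ.+ (p ^ x) ℤ.+ ℤ.+ (z ^ 2)       ≡⟨ cong₂ ℤ._+_ (pos-^ p x) (pos-^ z 2) ⟨
  (ℤ.+ p) ℤ.^ x ℤ.+ (ℤ.+ z) ℤ.^ 2   ≡⟨ -i+j≡k⇒j≡i+k ((ℤ.+ p) ℤ.^ x) _ _ sol ⟨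
  (ℤ.+ Q) ℤ.^ y                     ≡⟨ pos-^ Q y ⟩
  ℤ.+ (Q ^ y)                       ∎)
  where
  Q = 2 ^ k * (2 * p + 1)
  open ≡-Reasoning

listed⇒solution : ∀ {p k x y z} → Listed p k x y z → IsSolution p k x y z
listed⇒solution (inj₁ (refl , refl , refl))                                   = refl
listed⇒solution (inj₂ (inj₁ (refl , refl , refl , refl , refl)))                = refl
listed⇒solution (inj₂ (inj₂ (inj₁ (refl , refl , refl , refl , refl))))         = refl
listed⇒solution (inj₂ (inj₂ (inj₂ (inj₁ (refl , refl , refl , refl , refl))))) = refl
listed⇒solution (inj₂ (inj₂ (inj₂ (inj₂ (refl , refl , refl , refl , refl))))) = refl

equation⇒listed : Prime p → Mod8Cond p → ∀ k → k ≥ 1 → ∀ x y z →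
                  p ^ x + z * z ≡ (2 ^ k * (2 * p + 1)) ^ y → Listed p k x y z
equation⇒listed pr md k _ x 0 z eq with p^x+z*z≡1⇒x≡0∧z≡0 pr eq
... | x≡0 , z≡0 = inj₁ (x≡0 , refl , z≡0)
equation⇒listed {p} pr md 1 _ x 1 z eq = ⊥-elim (p^x+z*z≢2+4p pr md x z (trans eq Q≡2+4p))
  where
  Q≡2+4p : 2 * 1 * (2 * p + 1) * 1 ≡ 2 + 4 * p
  Q≡2+4p = solve (p ∷ [])
equation⇒listed {p} pr md 1 _ x 2 z eq = p^x+z*z≡[2+4p]²⇒listed pr md x z (trans eq Q²≡[2+4p]²)
  where
  Q²≡[2+4p]² : 2 * 1 * (2 * p + 1) * (2 * 1 * (2 * p + 1) * 1) ≡ (2 + 4 * p) * (2 + 4 * p)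
  Q²≡[2+4p]² = solve (p ∷ [])
equation⇒listed {p} pr md 2 _ x 1 z eq = p^x+z*z≡4+8p⇒listed pr md x z (trans eq Q≡4+8p)
  where
  Q≡4+8p : 2 * (2 * 1) * (2 * p + 1) * 1 ≡ 4 + 8 * p
  Q≡4+8p = solve (p ∷ [])
equation⇒listed _ _ 0 () x (suc y) z eq
equation⇒listed {p} _ md 1 _ x (suc (suc (suc y))) z eq = ⊥-elim
  (3≤k*y⇒p^x+z*z≢[2^k*m]^y p x z 1 (2 * p + 1) (3 + y) md
    (s≤s (s≤s (s≤s z≤n))) eq)
equation⇒listed {p} _ md 2 _ x (suc (suc y)) z eq = ⊥-elim
  (3≤k*y⇒p^x+z*z≢[2^k*m]^y p x z 2 (2 * p + 1) (2 + y) md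
    (≤-trans (n≤1+n 3) (*-monoʳ-≤ 2 (s≤s (s≤s z≤n)))) eq)
equation⇒listed {p} _ md (suc (suc (suc k))) _ x (suc y) z eq = ⊥-elim
  (3≤k*y⇒p^x+z*z≢[2^k*m]^y p x z (3 + k) (2 * p + 1) (1 + y) md
    (*-mono-≤ (m≤m+n 3 k) (s≤s z≤n)) eq)

theorem4p5 : (p k : ℕ) → SophieGermain p → Mod8Cond p → k ≥ 1 →
    (x y z : ℕ) → IsSolution p k x y z ⇔ Listed p k x y z
theorem4p5 p k (p-prime , _) md k≥1 x y z =
  mk⇔ (equation⇒listed p-prime md k k≥1 x y z ∘ solution⇒equation {p} {k} {x} {y} {z})
      listed⇒solution
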